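{- The numbers $h(n)$, $n\in\mathbb{N}$, satisfy $h(1)=0$, $h(2)=1$, and $h(n)=h\!\left(2^{\lceil\lg n\rceil}-n\right)+1$ for all $n>2$ (with the convention $h(0)=0$).
   Context: $\lg$ denotes the base-2 logarithm. For $i\in\mathbb{N}$ and $n\in\mathbb{N}_0$, $d_i(n)=2^{i-1}-\left|(n\bmod 2^i)-2^{i-1}\right|$. For $n\ge2$, $h(n)$ is the number of hypercubic bipartitions of $n$, i.e. the number of pairs $(n_0,n_1)$ of integers with $n_0\ge n_1\ge1$, $n_0+n_1=n$ and $n_0-n_1=d_i(n)$ for some $i\in\{1,\ldots,\lceil\lg n\rceil\}$; equivalently $h(n)$ is one less than the number of distinct values in $\{d_i(n):i\in\mathbb{N}\}$. This last description also defines $h(0)=h(1)=0$. -}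

module Defs where

open import Data.Nat using (ℕ; zero; suc; _+_; _*_; _∸_; _^_; _≤_; _<_; _≟_)
open import Data.Nat.Properties using (m^n≢0)
open import Data.Nat.DivMod using (_%_; _/_)
open import Data.Nat.Logarithm using (⌈log₂_⌉)
open import Data.List using (List; []; _∷_; length; filter; map; upTo; applyUpTo)
open import Data.List.Membership.DecPropositional _≟_ using (_∈?_)

absDiff : ℕ → ℕ → ℕ
absDiff a b = (a ∸ b) + (b ∸ a)

d : ℕ → ℕ → ℕ
d zero    n = 0   -- unused: i ranges over ℕ = {1,2,...}
d (suc j) n = 2 ^ j ∸ absDiff ((n % (2 ^ suc j)) {{m^n≢0 2 (suc j)}}) (2 ^ j)

dList : ℕ → List ℕ
dList n = map (λ k → d (suc k) n) (upTo ⌈log₂ n ⌉)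

-- h(n): number of pairs (n₀,n₁) with n₀ ≥ n₁ ≥ 1, n₀ + n₁ = n and
-- n₀ - n₁ = d_i(n) for some i ∈ {1,…,⌈lg n⌉}.  Such a pair is determined
-- by n₁ ∈ {1,…,⌊n/2⌋} (then n₀ = n - n₁ ≥ n₁), so we count those n₁ with
-- (n - n₁) - n₁ ∈ dList n.
h : ℕ → ℕ
h zero          = 0
h (suc zero)    = 0
h n@(suc (suc _)) =
  length (filter (λ n₁ → ((n ∸ n₁) ∸ n₁) ∈? dList n) (applyUpTo suc (n / 2)))

-- The d_i(n) for i ≤ ⌈lg n⌉ = k are unchanged when n is replaced by its reflection m = 2^k − n,
-- since 2^i divides n + m and d_i only sees n mod 2^i up to the symmetry r ↦ 2^i − r.
-- Moreover every d_i is at most its argument, and d_k(m) = m because m ≤ 2^{k−1}.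
-- Writing n = 2t + m with t = n − 2^{k−1} ≥ 1, the differences n₀ − n₁ of the bipartitions of n
-- are n − 2, n − 4, …: those above m never occur, m occurs once (n₁ = t), and those below m
-- are exactly the differences of the hypercubic bipartitions of m.
module Submission where

open import Defs
open import Data.Nat using (ℕ; _+_; _∸_; _^_; _>_)
open import Data.Nat.Logarithm using (⌈log₂_⌉)
open import Data.Product using (_×_)
open import Relation.Binary.PropositionalEquality using (_≡_)

open import Data.Nat using (zero; suc; _*_; _≤_; _<_; z≤n; s≤s; s≤s⁻¹; z<s; ⌈_/2⌉; _≟_; _<?_)
open import Data.Nat.Properties
open import Data.Nat.DivMod using (_%_; _/_; m%n<n; m%n≤m; m<n⇒m%n≡m; %-distribˡ-+; m/n≡1+[m∸n]/n)
open import Data.Nat.Divisibility using (_∣_; divides; m%n≡0⇒n∣m; n∣m⇒m%n≡0)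
open import Data.Nat.Logarithm using (⌈log₂⌉-mono-≤; ⌈log₂2^n⌉≡n)
open import Data.Nat.Logarithm.Core using (⌈log2⌉)
open import Data.Nat.Induction using (<-wellFounded)
open import Induction.WellFounded using (Acc; acc)
open import Data.List using (List; []; _∷_; length; filter; map; applyUpTo)
open import Data.List.Properties using (map-applyUpTo; map-∘; map-cong; filter-accept; filter-reject)
open import Data.List.Membership.DecPropositional _≟_ using (_∈_; _∈?_)
open import Data.List.Membership.Propositional.Properties using (∈-map⁺; ∈-map⁻; ∈-upTo⁺; ∈-upTo⁻)
open import Data.Product using (_,_; ∃-syntax)
open import Data.Sum using (_⊎_; inj₁; inj₂; map₂)
open import Data.Bool using (true; false)
open import Function using (_∘_)
open import Relation.Nullary using (does; yes; no; contradiction)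
open import Relation.Unary using (Pred; Decidable)
open import Relation.Binary.PropositionalEquality using (refl; sym; trans; cong; cong₂; subst; subst₂; module ≡-Reasoning)

^-monoʳ-∣ : ∀ a {m n} → m ≤ n → a ^ m ∣ a ^ n
^-monoʳ-∣ a {m} {n} m≤n = divides (a ^ (n ∸ m)) (begin
  a ^ n                 ≡⟨ cong (a ^_) (sym (m+[n∸m]≡n m≤n)) ⟩
  a ^ (m + (n ∸ m))     ≡⟨ ^-distribˡ-+-* a m (n ∸ m) ⟩
  a ^ m * a ^ (n ∸ m)   ≡⟨ *-comm (a ^ m) (a ^ (n ∸ m)) ⟩
  a ^ (n ∸ m) * a ^ m   ∎)
  where open ≡-Reasoning

n∣m∧m<n+n⇒m≡0⊎m≡n : ∀ {m n} → n ∣ m → m < n + n → m ≡ 0 ⊎ m ≡ n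
n∣m∧m<n+n⇒m≡0⊎m≡n         (divides zero          m≡0)   _      = inj₁ m≡0
n∣m∧m<n+n⇒m≡0⊎m≡n {n = n} (divides (suc zero)    m≡n+0) _      = inj₂ (trans m≡n+0 (+-identityʳ n))
n∣m∧m<n+n⇒m≡0⊎m≡n {n = n} (divides (suc (suc q)) refl)  m<n+n =
  contradiction m<n+n (≤⇒≯ (+-monoʳ-≤ n (m≤m+n n (q * n))))

∸-reflect : ∀ {s r p} → s + r ≡ p + p → s ∸ p ≡ p ∸ r
∸-reflect {s} {r} {p} s+r≡p+p = begin
  s ∸ p               ≡⟨ [m+n]∸[m+o]≡n∸o r s p ⟨
  (r + s) ∸ (r + p)   ≡⟨ cong₂ _∸_ (trans (+-comm r s) s+r≡p+p) (+-comm r p) ⟩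
  (p + p) ∸ (p + r)   ≡⟨ [m+n]∸[m+o]≡n∸o p p r ⟩
  p ∸ r               ∎
  where open ≡-Reasoning

absDiff-reflect : ∀ {s r p} → s + r ≡ p + p → absDiff s p ≡ absDiff r p
absDiff-reflect {s} {r} {p} s+r≡p+p =
  trans (cong₂ _+_ (∸-reflect {s} {r} {p} s+r≡p+p) (sym (∸-reflect {r} {s} {p} (trans (+-comm r s) s+r≡p+p))))
        (+-comm (p ∸ r) (r ∸ p))

∸-absDiff-reflect : ∀ p {s r} → s + r ≡ 0 ⊎ s + r ≡ p + p → p ∸ absDiff s p ≡ p ∸ absDiff r p
∸-absDiff-reflect p {s}     (inj₁ s+r≡0)   = cong (λ x → p ∸ absDiff x p) (trans (m+n≡0⇒m≡0 s s+r≡0) (sym (m+n≡0⇒n≡0 s s+r≡0)))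
∸-absDiff-reflect p {s} {r} (inj₂ s+r≡p+p) = cong (p ∸_) (absDiff-reflect {s} {r} {p} s+r≡p+p)

∸-absDiff≤ : ∀ p r → p ∸ absDiff r p ≤ r
∸-absDiff≤ p r = begin
  p ∸ absDiff r p                  ≤⟨ ∸-monoˡ-≤ (absDiff r p) p≤r+absDiff ⟩
  (r + absDiff r p) ∸ absDiff r p  ≡⟨ m+n∸n≡m r (absDiff r p) ⟩
  r                                ∎
  where
  open ≤-Reasoning
  p≤r+absDiff : p ≤ r + absDiff r p
  p≤r+absDiff = ≤-trans (m≤n+m∸n p r) (+-monoʳ-≤ r (m≤n+m (p ∸ r) (r ∸ p)))

d≤ : ∀ i n → d (suc i) n ≤ n
d≤ i n = ≤-trans (∸-absDiff≤ (2 ^ i) (n % 2 ^ suc i)) (m%n≤m n (2 ^ suc i))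
  where instance _ = m^n≢0 2 (suc i)

d-small : ∀ i {n} → n ≤ 2 ^ i → d (suc i) n ≡ n
d-small i {n} n≤2^i = begin
  2 ^ i ∸ absDiff (n % 2 ^ suc i) (2 ^ i)  ≡⟨ cong (λ r → 2 ^ i ∸ absDiff r (2 ^ i)) (m<n⇒m%n≡m n<2^[1+i]) ⟩
  2 ^ i ∸ ((n ∸ 2 ^ i) + (2 ^ i ∸ n))      ≡⟨ cong (λ x → 2 ^ i ∸ (x + (2 ^ i ∸ n))) (m≤n⇒m∸n≡0 n≤2^i) ⟩
  2 ^ i ∸ (2 ^ i ∸ n)                      ≡⟨ m∸[m∸n]≡n n≤2^i ⟩
  n                                        ∎
  where
  open ≡-Reasoning
  instance _ = m^n≢0 2 (suc i)
  n<2^[1+i] : n < 2 ^ suc i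
  n<2^[1+i] = ≤-<-trans n≤2^i (^-monoʳ-< 2 (s≤s (s≤s z≤n)) (n<1+n i))

-- The residues of a and b modulo 2 ^ suc i sum to 0 or to 2 ^ suc i.
d-reflect : ∀ i {a b} → 2 ^ suc i ∣ a + b → d (suc i) a ≡ d (suc i) b
d-reflect i {a} {b} M∣a+b = ∸-absDiff-reflect (2 ^ i) (map₂ (λ s+r≡M → trans s+r≡M M≡2^i+2^i) residues)
  where
  M = 2 ^ suc i
  instance _ = m^n≢0 2 (suc i)
  M≡2^i+2^i : M ≡ 2 ^ i + 2 ^ i
  M≡2^i+2^i = cong (2 ^ i +_) (+-identityʳ (2 ^ i))
  M∣s+r : M ∣ a % M + b % M
  M∣s+r = m%n≡0⇒n∣m _ M (trans (sym (%-distribˡ-+ a b M)) (n∣m⇒m%n≡0 (a + b) M M∣a+b))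
  residues : a % M + b % M ≡ 0 ⊎ a % M + b % M ≡ M
  residues = n∣m∧m<n+n⇒m≡0⊎m≡n M∣s+r (+-mono-< (m%n<n a M) (m%n<n b M))

2+n≤2*[1+⌈n/2⌉] : ∀ n → 2 + n ≤ 2 * suc ⌈ n /2⌉
2+n≤2*[1+⌈n/2⌉] zero          = ≤-refl
2+n≤2*[1+⌈n/2⌉] (suc zero)    = n≤1+n 3
2+n≤2*[1+⌈n/2⌉] (suc (suc n)) =
  subst (4 + n ≤_) (sym (*-suc 2 (suc ⌈ n /2⌉))) (s≤s (s≤s (2+n≤2*[1+⌈n/2⌉] n)))

n≤2^⌈log2⌉n : ∀ n (rec : Acc _<_ n) → n ≤ 2 ^ ⌈log2⌉ n rec
n≤2^⌈log2⌉n zero          _        = z≤n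
n≤2^⌈log2⌉n (suc zero)    _        = ≤-refl
n≤2^⌈log2⌉n (suc (suc n)) (acc rs) =
  ≤-trans (2+n≤2*[1+⌈n/2⌉] n) (*-monoʳ-≤ 2 (n≤2^⌈log2⌉n (suc ⌈ n /2⌉) (rs (⌈n/2⌉<n n))))

n≤2^⌈log₂n⌉ : ∀ n → n ≤ 2 ^ ⌈log₂ n ⌉
n≤2^⌈log₂n⌉ n = n≤2^⌈log2⌉n n (<-wellFounded n)

⌈log₂n⌉≡1+k⇒2^k<n : ∀ {n k} → ⌈log₂ n ⌉ ≡ suc k → 2 ^ k < n
⌈log₂n⌉≡1+k⇒2^k<n {n} {k} log-n = ≰⇒> λ n≤2^k →
  1+n≰n (subst₂ _≤_ log-n (⌈log₂2^n⌉≡n k) (⌈log₂⌉-mono-≤ n≤2^k))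

∈-dList⁺ : ∀ {i n} → i < ⌈log₂ n ⌉ → d (suc i) n ∈ dList n
∈-dList⁺ {n = n} i<k = ∈-map⁺ (λ j → d (suc j) n) (∈-upTo⁺ i<k)

∈-dList⁻ : ∀ {x n} → x ∈ dList n → ∃[ i ] i < ⌈log₂ n ⌉ × x ≡ d (suc i) n
∈-dList⁻ {n = n} x∈ with (i , i∈ , x≡) ← ∈-map⁻ (λ j → d (suc j) n) x∈ = i , ∈-upTo⁻ i∈ , x≡

gaps : ℕ → List ℕ
gaps zero          = []
gaps (suc zero)    = []
gaps (suc (suc n)) = n ∷ gaps n

∸-twice-suc : ∀ n x → suc (suc n) ∸ suc x ∸ suc x ≡ n ∸ x ∸ x
∸-twice-suc n x = begin
  suc n ∸ x ∸ suc x     ≡⟨ ∸-+-assoc (suc n) x (suc x) ⟩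
  suc n ∸ (x + suc x)   ≡⟨ cong (suc n ∸_) (+-suc x x) ⟩
  n ∸ (x + x)           ≡⟨ ∸-+-assoc n x x ⟨
  n ∸ x ∸ x             ∎
  where open ≡-Reasoning

bipartition-gaps : ∀ n → map (λ n₁ → n ∸ n₁ ∸ n₁) (applyUpTo suc (n / 2)) ≡ gaps n
bipartition-gaps zero          = refl
bipartition-gaps (suc zero)    = refl
bipartition-gaps (suc (suc n)) = begin
  map (gap (2 + n)) (applyUpTo suc ((2 + n) / 2))       ≡⟨ cong (map (gap (2 + n)) ∘ applyUpTo suc) (m/n≡1+[m∸n]/n {2 + n} (s≤s (s≤s z≤n))) ⟩
  n ∷ map (gap (2 + n)) (applyUpTo (suc ∘ suc) (n / 2)) ≡⟨ cong (λ xs → n ∷ map (gap (2 + n)) xs) (map-applyUpTo suc suc (n / 2)) ⟨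
  n ∷ map (gap (2 + n)) (map suc (applyUpTo suc (n / 2))) ≡⟨ cong (n ∷_) (map-∘ (applyUpTo suc (n / 2))) ⟨
  n ∷ map (gap (2 + n) ∘ suc) (applyUpTo suc (n / 2))   ≡⟨ cong (n ∷_) (map-cong (∸-twice-suc n) (applyUpTo suc (n / 2))) ⟩
  n ∷ map (gap n) (applyUpTo suc (n / 2))               ≡⟨ cong (n ∷_) (bipartition-gaps n) ⟩
  n ∷ gaps n                                            ∎
  where
  open ≡-Reasoning
  gap : ℕ → ℕ → ℕ
  gap n n₁ = n ∸ n₁ ∸ n₁

length-filter-map : ∀ {a b p} {A : Set a} {B : Set b} {P : Pred B p} (P? : Decidable P) (f : A → B) xs →
                    length (filter P? (map f xs)) ≡ length (filter (P? ∘ f) xs)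
length-filter-map P? f []       = refl
length-filter-map P? f (x ∷ xs) with does (P? (f x))
... | true  = cong suc (length-filter-map P? f xs)
... | false = length-filter-map P? f xs

gapCount : List ℕ → ℕ → ℕ
gapCount D n = length (filter (_∈? D) (gaps n))

h≡gapCount : ∀ n → h n ≡ gapCount (dList n) n
h≡gapCount zero            = refl
h≡gapCount (suc zero)      = refl
h≡gapCount n@(suc (suc _)) = trans (sym (length-filter-map (_∈? dList n) (λ n₁ → n ∸ n₁ ∸ n₁) (applyUpTo suc (n / 2))))
                                   (cong (length ∘ filter (_∈? dList n)) (bipartition-gaps n))

gapCount-cong : ∀ {D E} n → (∀ {x} → x < n → x ∈ D → x ∈ E) → (∀ {x} → x < n → x ∈ E → x ∈ D) →
                gapCount D n ≡ gapCount E n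
gapCount-cong zero          _   _   = refl
gapCount-cong (suc zero)    _   _   = refl
gapCount-cong {D} {E} (suc (suc n)) D⊆E E⊆D
  with n ∈? D | n ∈? E | gapCount-cong n (D⊆E ∘ m<n⇒m<2+n) (E⊆D ∘ m<n⇒m<2+n)
  where
  m<n⇒m<2+n : ∀ {x} → x < n → x < 2 + n
  m<n⇒m<2+n x<n = <-≤-trans x<n (m≤n+m n 2)
... | yes _   | yes _   | same = cong suc same
... | no _    | no _    | same = same
... | yes n∈D | no n∉E  | _    = contradiction (D⊆E (m≤n+m (suc n) 1) n∈D) n∉E
... | no n∉D  | yes n∈E | _    = contradiction (E⊆D (m≤n+m (suc n) 1) n∈E) n∉D

gapCount-top : ∀ {D m} → (∀ {y} → y ∈ D → y ≤ m) → m ∈ D → ∀ t → 0 < t →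
               gapCount D (t + t + m) ≡ suc (gapCount D m)
gapCount-top {D} {m} _ m∈D (suc zero) _ = cong length (filter-accept (_∈? D) m∈D)
gapCount-top {D} {m} bounded m∈D (suc (suc t)) _ = begin
  gapCount D (suc (suc t + suc (suc t) + m))  ≡⟨ cong (λ x → gapCount D (suc (x + m))) (+-suc (suc t) (suc t)) ⟩
  gapCount D (2 + (suc t + suc t + m))        ≡⟨ cong length (filter-reject (_∈? D) (<⇒≱ (m<n+m m z<s) ∘ bounded)) ⟩
  gapCount D (suc t + suc t + m)              ≡⟨ gapCount-top bounded m∈D (suc t) z<s ⟩
  suc (gapCount D m)                          ∎
  where open ≡-Reasoning

n≡t+t+[2p∸n] : ∀ {p n} → p ≤ n → n ≤ 2 * p → let t = n ∸ p in n ≡ t + t + (2 * p ∸ n)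
n≡t+t+[2p∸n] {p} {n} p≤n n≤2p = sym (begin
  t + t + (2 * p ∸ n)        ≡⟨ cong (λ x → t + t + (2 * p ∸ x)) p+t≡n ⟨
  t + t + (2 * p ∸ (p + t))  ≡⟨ cong (t + t +_) ([m+n]∸[m+o]≡n∸o p (p + 0) t) ⟩
  t + t + (p + 0 ∸ t)        ≡⟨ cong (λ x → t + t + (x ∸ t)) (+-identityʳ p) ⟩
  t + t + (p ∸ t)            ≡⟨ +-assoc t t (p ∸ t) ⟩
  t + (t + (p ∸ t))          ≡⟨ cong (t +_) (m+[n∸m]≡n t≤p) ⟩
  t + p                      ≡⟨ +-comm t p ⟩
  p + t                      ≡⟨ p+t≡n ⟩
  n                          ∎)
  where
  open ≡-Reasoning
  t = n ∸ p
  p+t≡n : p + t ≡ n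
  p+t≡n = m+[n∸m]≡n p≤n
  t≤p : t ≤ p
  t≤p = +-cancelˡ-≤ p t p (subst₂ _≤_ (sym p+t≡n) (cong (p +_) (+-identityʳ p)) n≤2p)

module Reflection {n m k : ℕ} (log-n : ⌈log₂ n ⌉ ≡ suc k) (m≤2^k : m ≤ 2 ^ k) (m≤n : m ≤ n)
         (d-agree : ∀ {i} → i ≤ k → d (suc i) n ≡ d (suc i) m) where

  private
    d-agree<⌈log₂n⌉ : ∀ {i} → i < ⌈log₂ n ⌉ → d (suc i) n ≡ d (suc i) m
    d-agree<⌈log₂n⌉ {i} i<k = d-agree (s≤s⁻¹ (subst (i <_) log-n i<k))

  dList-bounded : ∀ {y} → y ∈ dList n → y ≤ m
  dList-bounded y∈ with i , i<k , refl ← ∈-dList⁻ y∈ = subst (_≤ m) (sym (d-agree<⌈log₂n⌉ i<k)) (d≤ i m)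

  ∈-dList-top : m ∈ dList n
  ∈-dList-top = subst (_∈ dList n) (trans (d-agree ≤-refl) (d-small k m≤2^k))
                      (∈-dList⁺ (subst (k <_) (sym log-n) (n<1+n k)))

  dList-below : ∀ {x} → x < m → x ∈ dList n → x ∈ dList m
  dList-below x<m x∈ with i , i<k , refl ← ∈-dList⁻ x∈ with i <? ⌈log₂ m ⌉
  ... | yes i<log-m = subst (_∈ dList m) (sym (d-agree<⌈log₂n⌉ i<k)) (∈-dList⁺ i<log-m)
  ... | no  i≮log-m = contradiction (trans (d-agree<⌈log₂n⌉ i<k) (d-small i m≤2^i)) (<⇒≢ x<m)
    where
    m≤2^i : m ≤ 2 ^ i
    m≤2^i = ≤-trans (n≤2^⌈log₂n⌉ m) (^-monoʳ-≤ 2 (≮⇒≥ i≮log-m))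

  dList-mono : ∀ {x} → x ∈ dList m → x ∈ dList n
  dList-mono x∈ with i , i<log-m , refl ← ∈-dList⁻ x∈ =
    subst (_∈ dList n) (d-agree<⌈log₂n⌉ i<k) (∈-dList⁺ i<k)
    where
    i<k : i < ⌈log₂ n ⌉
    i<k = <-≤-trans i<log-m (⌈log₂⌉-mono-≤ m≤n)

h-reflect : ∀ {n k} → ⌈log₂ n ⌉ ≡ suc k → h n ≡ suc (h (2 ^ suc k ∸ n))
h-reflect {n} {k} log-n = begin
  h n                             ≡⟨ h≡gapCount n ⟩
  gapCount (dList n) n            ≡⟨ cong (gapCount (dList n)) (n≡t+t+[2p∸n] (<⇒≤ 2^k<n) n≤2^[1+k]) ⟩
  gapCount (dList n) (t + t + m)  ≡⟨ gapCount-top dList-bounded ∈-dList-top t (m<n⇒0<n∸m 2^k<n) ⟩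
  suc (gapCount (dList n) m)      ≡⟨ cong suc (gapCount-cong m dList-below (λ _ → dList-mono)) ⟩
  suc (gapCount (dList m) m)      ≡⟨ cong suc (h≡gapCount m) ⟨
  suc (h m)                       ∎
  where
  open ≡-Reasoning
  m = 2 ^ suc k ∸ n
  t = n ∸ 2 ^ k
  2^k<n : 2 ^ k < n
  2^k<n = ⌈log₂n⌉≡1+k⇒2^k<n log-n
  n≤2^[1+k] : n ≤ 2 ^ suc k
  n≤2^[1+k] = subst (λ e → n ≤ 2 ^ e) log-n (n≤2^⌈log₂n⌉ n)
  m≤2^k : m ≤ 2 ^ k
  m≤2^k = ≤-trans (∸-monoʳ-≤ (2 ^ suc k) (<⇒≤ 2^k<n))
                  (≤-reflexive (trans (m+n∸m≡n (2 ^ k) (2 ^ k + 0)) (+-identityʳ (2 ^ k))))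
  d-agree : ∀ {i} → i ≤ k → d (suc i) n ≡ d (suc i) m
  d-agree {i} i≤k = d-reflect i (subst (2 ^ suc i ∣_) (sym (m+[n∸m]≡n n≤2^[1+k])) (^-monoʳ-∣ 2 (s≤s i≤k)))
  open Reflection log-n m≤2^k (≤-trans m≤2^k (<⇒≤ 2^k<n)) d-agree

recurrence : ∀ n → 2 ≤ n → h n ≡ h (2 ^ ⌈log₂ n ⌉ ∸ n) + 1
recurrence n 2≤n with ⌈log₂ n ⌉ in log-n
... | zero  = contradiction (subst (λ e → n ≤ 2 ^ e) log-n (n≤2^⌈log₂n⌉ n)) (<⇒≱ 2≤n)
... | suc k = trans (h-reflect {n} log-n) (+-comm 1 (h (2 ^ suc k ∸ n)))

corollary16 : (h 0 ≡ 0) × (h 1 ≡ 0) × (h 2 ≡ 1) ×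
    (∀ (n : ℕ) → n > 2 → h n ≡ h (2 ^ ⌈log₂ n ⌉ ∸ n) + 1)
corollary16 = refl , refl , refl , λ n n>2 → recurrence n (<⇒≤ n>2)
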